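{- Let $M=(X,rk)$ be a matroid of rank $r=rk(X)$ and let $i$ be a nonnegative integer. Then $d_1(M)>r-i$ if and only if \[ [x^i]\,T_M(x,1)=\binom{|X|-i-1}{r-i}. \]
   Context: For a matroid $M=(X,rk)$ with $r=rk(X)$, the Tutte polynomial is $T_M(x,y)=\sum_{A\subseteq X}(x-1)^{r-rk(A)}(y-1)^{|A|-rk(A)}$, and $[x^i]f(x)$ denotes the coefficient of $x^i$. A circuit is a set $C\subseteq X$ with $rk(C\setminus\{e\})=|C|-1=rk(C)$ for all $e\in C$. $d_1(M)$ is the minimum size of a circuit of $M$. -}

module Defs where

open import Data.Nat as ℕ using (ℕ; zero; suc)
open import Data.Nat.Combinatorics using (_C_)
open import Data.Integer as ℤ using (ℤ; +_; -[1+_]; 0ℤ; 1ℤ; -1ℤ)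
open import Data.List using (List; []; _∷_; map; foldr)
open import Data.Vec using (_∷_; [])
open import Data.Bool using (true; false)
open import Data.Fin using (Fin)
open import Data.Fin.Subset using (Subset; _⊆_; _∪_; _∩_; _─_; ⁅_⁆; _∈_; ∣_∣; ⊤)

record Matroid (n : ℕ) : Set where
  field
    rk          : Subset n → ℕ
    rk-bounded  : ∀ A → rk A ℕ.≤ ∣ A ∣
    rk-mono     : ∀ {A B} → A ⊆ B → rk A ℕ.≤ rk B
    rk-submod   : ∀ A B → rk (A ∪ B) ℕ.+ rk (A ∩ B) ℕ.≤ rk A ℕ.+ rk B

open Matroid public

rank : ∀ {n} → Matroid n → ℕ
rank M = rk M ⊤

-- C is a circuit: rk(C \ {e}) = |C| - 1 = rk(C) for all e ∈ C.
-- (Written with "+ 1" to avoid truncated subtraction; this forces C ≠ ∅.)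
IsCircuit : ∀ {n} → Matroid n → Subset n → Set
IsCircuit M C =
  (rk M C ℕ.+ 1 ≡ ∣ C ∣) × (∀ e → e ∈ C → rk M (C ─ ⁅ e ⁆) ℕ.+ 1 ≡ ∣ C ∣)
  where
    open import Relation.Binary.PropositionalEquality using (_≡_)
    open import Data.Product using (_×_)

-- "d₁(M) > t" (d₁ = minimum circuit size; d₁ = ∞ if there are no circuits)
d₁> : ∀ {n} → Matroid n → ℤ → Set
d₁> M t = ∀ C → IsCircuit M C → t ℤ.< + ∣ C ∣

-- Polynomials with integer coefficients as coefficient lists
-- (lowest degree first).

Poly : Set
Poly = List ℤ

_+P_ : Poly → Poly → Poly
[] +P q = q
(a ∷ p) +P [] = a ∷ p
(a ∷ p) +P (b ∷ q) = (a ℤ.+ b) ∷ (p +P q)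

scaleP : ℤ → Poly → Poly
scaleP c = map (c ℤ.*_)

_*P_ : Poly → Poly → Poly
[] *P q = []
(a ∷ p) *P q = scaleP a q +P (0ℤ ∷ (p *P q))

_^P_ : Poly → ℕ → Poly
p ^P zero = 1ℤ ∷ []
p ^P suc k = p *P (p ^P k)

x-1 : Poly
x-1 = -1ℤ ∷ 1ℤ ∷ []

coeff : ℕ → Poly → ℤ
coeff i [] = 0ℤ
coeff zero (a ∷ p) = a
coeff (suc i) (a ∷ p) = coeff i p

evalP : Poly → ℤ → ℤ
evalP p z = foldr (λ a acc → a ℤ.+ z ℤ.* acc) 0ℤ p

-- Bivariate polynomials: polynomials in x whose coefficients are
-- polynomials in y.
Poly2 : Set
Poly2 = List Poly

_+P2_ : Poly2 → Poly2 → Poly2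
[] +P2 q = q
(a ∷ p) +P2 [] = a ∷ p
(a ∷ p) +P2 (b ∷ q) = (a +P b) ∷ (p +P2 q)

_⊗_ : Poly → Poly → Poly2
px ⊗ py = map (λ c → scaleP c py) px

evalY : Poly2 → ℤ → Poly
evalY T z = map (λ c → evalP c z) T

allSubsets : (n : ℕ) → List (Subset n)
allSubsets zero = [] ∷ []
allSubsets (suc n) =
  foldr (λ A acc → (false ∷ A) ∷ (true ∷ A) ∷ acc) [] (allSubsets n)

-- Tutte polynomial
-- T_M(x,y) = Σ_{A ⊆ X} (x-1)^{r - rk A} (y-1)^{|A| - rk A}
-- (exponents are nonnegative by R1/R2, so ℕ subtraction is exact)

tutte : ∀ {n} → Matroid n → Poly2
tutte {n} M =
  foldr (λ A acc →
           ((x-1 ^P (rank M ℕ.∸ rk M A)) ⊗ (x-1 ^P (∣ A ∣ ℕ.∸ rk M A)))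
           +P2 acc)
        [] (allSubsets n)

-- Generalised binomial coefficient  binom m k  for integers m, k:
--   0 if k < 0;  m(m-1)...(m-k+1)/k! if k ≥ 0,
-- i.e. C(n,k) for m = n ≥ 0 and (-1)^k C(j+k,k) for m = -(j+1).

binomℤ : ℤ → ℤ → ℤ
binomℤ m -[1+ _ ] = 0ℤ
binomℤ (+ a) (+ k) = + (a C k)
binomℤ -[1+ j ] (+ k) = sgn k ℤ.* + ((j ℕ.+ k) C k)
  where
    sgn : ℕ → ℤ
    sgn zero = 1ℤ
    sgn (suc k) = ℤ.- sgn k

{-# OPTIONS --safe #-}
-- At y = 1 only independent sets contribute to the Tutte polynomial, so
-- c(M) = [x^i] T_M(x,1) = Σ_{A independent} [x^i] (x-1)^(r-|A|). Splitting off one element e,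
-- c(M) = c(M∖e) + c(M/e) if e is neither a loop nor a coloop, c(M) = c(M∖e) if e is a loop, and
-- c_i(M) = c_(i-1)(M∖e) (with c_0(M) = 0) if e is a coloop. The numbers C(n-i-1, r-i) obey the
-- matching Pascal rule, so induction on |X| gives c(M) ≤ C(|X|-i-1, r-i), with equality exactly
-- when every set of at most r-i elements is independent; the inequality is what lets equality of
-- a sum force equality of both summands. Finally, all sets of at most r-i elements are
-- independent iff every circuit has more than r-i elements, as every dependent set contains a circuit.
module Submission where

open import Defs
open import Data.Nat as ℕ using (ℕ; zero; suc; pred; _∸_; _≤_; _<_; z≤n; s≤s)
import Data.Nat.Properties as ℕP
open import Data.Nat.Combinatorics using (_C_; nCk+nC[k+1]≡[n+1]C[k+1]; k>n⇒nCk≡0)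
open import Data.Integer as ℤ using (ℤ; +_; 0ℤ; 1ℤ; -1ℤ; _+_; _*_; -_; _-_; _⊖_)
import Data.Integer.Properties as ℤP
open import Data.Integer.Solver using (module +-*-Solver)
open import Data.List using (List; []; _∷_; map; foldr)
import Data.List.Properties as LP
open import Data.Bool using (true; false)
open import Data.Vec using (_∷_; []; here; there)
open import Data.Fin.Properties using (any?)
open import Data.Fin.Subset using (Subset; _⊂_; _∪_; _∩_; _─_; ⁅_⁆; _∈_; ∣_∣; ⊤; ⊥; ∁)
open import Data.Fin.Subset.Properties
  using (_∈?_; ∣p∣≤n; ∣⊥∣≡0; ∣⊤∣≡n; ∣∁p∣≡n∸∣p∣; ∣p─q∣≤∣p∣; nonempty?; Empty-unique; p─⊥≡p; p─q⊆p;
         x∈p⇒p-x⊂p; ⊆-refl; ⊆-min; ⊆-max; s⊆s; out⊆; ∪-identityˡ; ∪-zeroʳ; ∪-inverseʳ;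
         ∩-identityʳ; ∩-zeroˡ; ∩-inverseʳ)
open import Data.Fin.Subset.Induction using (⊂-wellFounded)
open import Data.Product using (∃-syntax; Σ-syntax; _×_; _,_)
open import Data.Sum using (inj₁; inj₂)
open import Function using (id; const)
open import Function.Bundles using (_⇔_; mk⇔; Equivalence)
open import Function.Construct.Composition using () renaming (equivalence to ⇔-trans)
open import Function.Construct.Symmetry using (⇔-sym)
open import Function.Construct.Identity using (⇔-id)
open import Induction.WellFounded using (Acc; acc)
open import Relation.Binary.PropositionalEquality
open import Relation.Nullary using (¬_; yes; no; contradiction)
open import Relation.Nullary.Decidable using (_×-dec_; ¬?; decidable-stable)
open +-*-Solver
open Equivalence using (to; from)

pred≡⇒≡suc : ∀ {x a} → 1 ≤ x → pred x ≡ a → x ≡ suc a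
pred≡⇒≡suc {suc x} _ = cong suc

pred-∸-pred : ∀ {x y} → 1 ≤ x → 1 ≤ y → pred x ∸ pred y ≡ x ∸ y
pred-∸-pred {suc x} {suc y} _ _ = refl

∸-pred : ∀ a {y} → 1 ≤ y → a ∸ pred y ≡ suc a ∸ y
∸-pred a {suc y} _ = refl

pred-+-mono-≤ : ∀ {a b c d} → 1 ≤ a → 1 ≤ b → 1 ≤ c → 1 ≤ d →
  a ℕ.+ b ≤ c ℕ.+ d → pred a ℕ.+ pred b ≤ pred c ℕ.+ pred d
pred-+-mono-≤ {suc a} {suc b} {suc c} {suc d} _ _ _ _ a+b≤c+d =
  ℕP.≤-pred (subst₂ _≤_ (ℕP.+-suc a b) (ℕP.+-suc c d) (ℕP.≤-pred a+b≤c+d))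

coeff-+P : ∀ i p q → coeff i (p +P q) ≡ coeff i p + coeff i q
coeff-+P i [] q = sym (ℤP.+-identityˡ _)
coeff-+P i (a ∷ p) [] = sym (ℤP.+-identityʳ _)
coeff-+P zero (a ∷ p) (b ∷ q) = refl
coeff-+P (suc i) (a ∷ p) (b ∷ q) = coeff-+P i p q

coeff-map : ∀ (h : ℤ → ℤ) → h 0ℤ ≡ 0ℤ → ∀ i p → coeff i (map h p) ≡ h (coeff i p)
coeff-map h h0≡0 i [] = sym h0≡0
coeff-map h h0≡0 zero (a ∷ p) = refl
coeff-map h h0≡0 (suc i) (a ∷ p) = coeff-map h h0≡0 i p

coeff-scaleP : ∀ c i p → coeff i (scaleP c p) ≡ c * coeff i p
coeff-scaleP c = coeff-map (c *_) (ℤP.*-zeroʳ c)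

coeff-[0] : ∀ i → coeff i (0ℤ ∷ []) ≡ 0ℤ
coeff-[0] zero = refl
coeff-[0] (suc i) = refl

coeff-x-1*P-zero : ∀ p → coeff 0 (x-1 *P p) ≡ - coeff 0 p
coeff-x-1*P-zero p = begin
    coeff 0 (x-1 *P p)                ≡⟨ coeff-+P 0 (scaleP -1ℤ p) _ ⟩
    coeff 0 (scaleP -1ℤ p) + 0ℤ       ≡⟨ ℤP.+-identityʳ _ ⟩
    coeff 0 (scaleP -1ℤ p)            ≡⟨ coeff-scaleP -1ℤ 0 p ⟩
    -1ℤ * coeff 0 p                   ≡⟨ ℤP.-1*i≡-i (coeff 0 p) ⟩
    - coeff 0 p                       ∎
  where open ≡-Reasoning

coeff-x-1*P-suc : ∀ i p → coeff (suc i) (x-1 *P p) ≡ coeff i p - coeff (suc i) p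
coeff-x-1*P-suc i p = begin
    coeff (suc i) (x-1 *P p)
  ≡⟨ coeff-+P (suc i) (scaleP -1ℤ p) _ ⟩
    coeff (suc i) (scaleP -1ℤ p) + coeff i (scaleP 1ℤ p +P (0ℤ ∷ []))
  ≡⟨ cong₂ _+_ (coeff-scaleP -1ℤ (suc i) p) (coeff-+P i (scaleP 1ℤ p) (0ℤ ∷ [])) ⟩
    -1ℤ * b + (coeff i (scaleP 1ℤ p) + coeff i (0ℤ ∷ []))
  ≡⟨ cong₂ (λ u v → -1ℤ * b + (u + v)) (coeff-scaleP 1ℤ i p) (coeff-[0] i) ⟩
    -1ℤ * b + (1ℤ * a + 0ℤ)
  ≡⟨ solve 2 (λ a b → con -1ℤ :* b :+ (con 1ℤ :* a :+ con 0ℤ) := a :- b) refl a b ⟩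
    a - b
  ∎
  where
  open ≡-Reasoning
  a = coeff i p
  b = coeff (suc i) p

evalP-+P : ∀ p q z → evalP (p +P q) z ≡ evalP p z + evalP q z
evalP-+P [] q z = sym (ℤP.+-identityˡ _)
evalP-+P (a ∷ p) [] z = sym (ℤP.+-identityʳ _)
evalP-+P (a ∷ p) (b ∷ q) z rewrite evalP-+P p q z =
  solve 5 (λ a b z u v → (a :+ b) :+ z :* (u :+ v) := (a :+ z :* u) :+ (b :+ z :* v))
        refl a b z (evalP p z) (evalP q z)

evalP-scaleP : ∀ c q z → evalP (scaleP c q) z ≡ c * evalP q z
evalP-scaleP c [] z = sym (ℤP.*-zeroʳ c)
evalP-scaleP c (a ∷ q) z rewrite evalP-scaleP c q z =
  solve 4 (λ c a z v → c :* a :+ z :* (c :* v) := c :* (a :+ z :* v)) refl c a z (evalP q z)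

evalP-*P : ∀ p q z → evalP (p *P q) z ≡ evalP p z * evalP q z
evalP-*P [] q z = refl
evalP-*P (a ∷ p) q z
  rewrite evalP-+P (scaleP a q) (0ℤ ∷ (p *P q)) z | evalP-scaleP a q z | evalP-*P p q z =
  solve 4 (λ a z u v → a :* v :+ (con 0ℤ :+ z :* (u :* v)) := (a :+ z :* u) :* v)
        refl a z (evalP p z) (evalP q z)

evalY-+P2 : ∀ p q z → evalY (p +P2 q) z ≡ evalY p z +P evalY q z
evalY-+P2 [] q z = refl
evalY-+P2 (a ∷ p) [] z = refl
evalY-+P2 (a ∷ p) (b ∷ q) z = cong₂ _∷_ (evalP-+P a b z) (evalY-+P2 p q z)

coeff-evalY-⊗ : ∀ i p q z → coeff i (evalY (p ⊗ q) z) ≡ coeff i p * evalP q z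
coeff-evalY-⊗ i p q z = begin
    coeff i (evalY (p ⊗ q) z)                      ≡⟨ cong (coeff i) (LP.map-∘ p) ⟨
    coeff i (map (λ c → evalP (scaleP c q) z) p)   ≡⟨ coeff-map _ (evalP-scaleP 0ℤ q z) i p ⟩
    evalP (scaleP (coeff i p) q) z                 ≡⟨ evalP-scaleP (coeff i p) q z ⟩
    coeff i p * evalP q z                          ∎
  where open ≡-Reasoning

coeffPow : ℕ → ℕ → ℤ
coeffPow m i = coeff i (x-1 ^P m)

powAt1 : ℕ → ℤ
powAt1 b = evalP (x-1 ^P b) 1ℤ

powAt1-suc : ∀ b → powAt1 (suc b) ≡ 0ℤ
powAt1-suc b = evalP-*P x-1 (x-1 ^P b) 1ℤ

powAt1-suc-∸ : ∀ a {r} → r ≤ a → powAt1 (suc a ∸ r) ≡ 0ℤ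
powAt1-suc-∸ a {r} r≤a = trans (cong powAt1 (ℕP.+-∸-assoc 1 r≤a)) (powAt1-suc (a ∸ r))

-- (x - 1)^(m+1) + (x - 1)^m = x (x - 1)^m, coefficientwise.

coeffPow-suc-+-zero : ∀ m → coeffPow (suc m) 0 + coeffPow m 0 ≡ 0ℤ
coeffPow-suc-+-zero m = begin
    coeffPow (suc m) 0 + coeffPow m 0   ≡⟨ cong (_+ coeffPow m 0) (coeff-x-1*P-zero (x-1 ^P m)) ⟩
    - coeffPow m 0 + coeffPow m 0       ≡⟨ ℤP.+-inverseˡ (coeffPow m 0) ⟩
    0ℤ                                  ∎
  where open ≡-Reasoning

coeffPow-suc-+-suc : ∀ m i → coeffPow (suc m) (suc i) + coeffPow m (suc i) ≡ coeffPow m i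
coeffPow-suc-+-suc m i = begin
    coeffPow (suc m) (suc i) + coeffPow m (suc i)
  ≡⟨ cong (_+ coeffPow m (suc i)) (coeff-x-1*P-suc i (x-1 ^P m)) ⟩
    coeffPow m i - coeffPow m (suc i) + coeffPow m (suc i)
  ≡⟨ solve 2 (λ a b → a :- b :+ b := a) refl (coeffPow m i) (coeffPow m (suc i)) ⟩
    coeffPow m i
  ∎
  where open ≡-Reasoning

sumOver : ∀ {A : Set} → List A → (A → ℤ) → ℤ
sumOver L f = foldr (λ a s → f a + s) 0ℤ L

module _ {A : Set} where

  sumOver-cong : ∀ (L : List A) {f g} → (∀ a → f a ≡ g a) → sumOver L f ≡ sumOver L g
  sumOver-cong [] f≡g = refl
  sumOver-cong (a ∷ L) f≡g = cong₂ _+_ (f≡g a) (sumOver-cong L f≡g)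

  sumOver-+ : ∀ (L : List A) f g → sumOver L (λ a → f a + g a) ≡ sumOver L f + sumOver L g
  sumOver-+ [] f g = refl
  sumOver-+ (a ∷ L) f g rewrite sumOver-+ L f g =
    solve 4 (λ u v x y → (u :+ v) :+ (x :+ y) := (u :+ x) :+ (v :+ y))
          refl (f a) (g a) (sumOver L f) (sumOver L g)

  sumOver-zero : ∀ (L : List A) {f} → (∀ a → f a ≡ 0ℤ) → sumOver L f ≡ 0ℤ
  sumOver-zero [] f≡0 = refl
  sumOver-zero (a ∷ L) f≡0 = cong₂ _+_ (f≡0 a) (sumOver-zero L f≡0)

  coeff-evalY-foldr : ∀ i z (G : A → Poly2) (L : List A) →
    coeff i (evalY (foldr (λ a acc → G a +P2 acc) [] L) z)
      ≡ sumOver L (λ a → coeff i (evalY (G a) z))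
  coeff-evalY-foldr i z G [] = refl
  coeff-evalY-foldr i z G (a ∷ L) = begin
      coeff i (evalY (G a +P2 rest) z)                   ≡⟨ cong (coeff i) (evalY-+P2 (G a) rest z) ⟩
      coeff i (evalY (G a) z +P evalY rest z)            ≡⟨ coeff-+P i (evalY (G a) z) _ ⟩
      coeff i (evalY (G a) z) + coeff i (evalY rest z)   ≡⟨ cong (λ s → coeff i (evalY (G a) z) + s) (coeff-evalY-foldr i z G L) ⟩
      sumOver (a ∷ L) (λ a → coeff i (evalY (G a) z))    ∎
    where
    open ≡-Reasoning
    rest = foldr (λ a acc → G a +P2 acc) [] L

sumOver-allSubsets-suc : ∀ n (f : Subset (suc n) → ℤ) →
  sumOver (allSubsets (suc n)) f ≡ sumOver (allSubsets n) (λ A → f (false ∷ A) + f (true ∷ A))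
sumOver-allSubsets-suc n f = interleave (allSubsets n)
  where
  interleave : ∀ L → sumOver (foldr (λ A acc → (false ∷ A) ∷ (true ∷ A) ∷ acc) [] L) f
                       ≡ sumOver L (λ A → f (false ∷ A) + f (true ∷ A))
  interleave [] = refl
  interleave (A ∷ L) = trans (cong (λ s → f (false ∷ A) + (f (true ∷ A) + s)) (interleave L))
                             (sym (ℤP.+-assoc (f (false ∷ A)) (f (true ∷ A)) _))

tutteTerm : ∀ {n} → Matroid n → ℕ → Subset n → ℤ
tutteTerm M i A = coeffPow (rank M ∸ rk M A) i * powAt1 (∣ A ∣ ∸ rk M A)

tutteCoeff : ∀ {n} → Matroid n → ℕ → ℤ
tutteCoeff {n} M i = sumOver (allSubsets n) (tutteTerm M i)

coeff-tutte-at-1 : ∀ {n} (M : Matroid n) i → coeff i (evalY (tutte M) 1ℤ) ≡ tutteCoeff M i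
coeff-tutte-at-1 {n} M i = trans (coeff-evalY-foldr i 1ℤ _ (allSubsets n))
  (sumOver-cong (allSubsets n) λ A →
    coeff-evalY-⊗ i (x-1 ^P (rank M ∸ rk M A)) (x-1 ^P (∣ A ∣ ∸ rk M A)) 1ℤ)

k≤n⇒0<nCk : ∀ {n k} → k ≤ n → 0 < n C k
k≤n⇒0<nCk {n} {zero} _ = s≤s z≤n
k≤n⇒0<nCk {suc n} {suc k} (s≤s k≤n) = begin-strict
    0                       <⟨ k≤n⇒0<nCk k≤n ⟩
    n C k                   ≤⟨ ℕP.m≤m+n (n C k) (n C suc k) ⟩
    n C k ℕ.+ n C suc k     ≡⟨ nCk+nC[k+1]≡[n+1]C[k+1] n k ⟩
    suc n C suc k           ∎
  where open ℕP.≤-Reasoning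

-- shiftedBinom n r i = C(n ∸ (i + 1), r - i) for i ≤ r, and 0 for i > r.

shiftedBinom : ℕ → ℕ → ℕ → ℕ
shiftedBinom n r zero = pred n C r
shiftedBinom n zero (suc i) = 0
shiftedBinom n (suc r) (suc i) = shiftedBinom (pred n) r i

binomℤ-⊖≡shiftedBinom : ∀ n r i → r ≤ n → binomℤ (n ⊖ suc i) (r ⊖ i) ≡ + shiftedBinom n r i
binomℤ-⊖≡shiftedBinom zero zero zero z≤n = refl
binomℤ-⊖≡shiftedBinom (suc n) r zero r≤n = refl
binomℤ-⊖≡shiftedBinom n zero (suc i) r≤n = refl
binomℤ-⊖≡shiftedBinom (suc n) (suc r) (suc i) (s≤s r≤n) =
  trans (cong₂ binomℤ (ℤP.[1+m]⊖[1+n]≡m⊖n n (suc i)) (ℤP.[1+m]⊖[1+n]≡m⊖n r i))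
        (binomℤ-⊖≡shiftedBinom n r i r≤n)

binomℤ≡shiftedBinom : ∀ n r i → r ≤ n →
  binomℤ (+ n - + i - 1ℤ) (+ r - + i) ≡ + shiftedBinom n r i
binomℤ≡shiftedBinom n r i r≤n = trans (cong₂ binomℤ n-i-1≡ (ℤP.m-n≡m⊖n r i))
                                      (binomℤ-⊖≡shiftedBinom n r i r≤n)
  where
  n-i-1≡ : + n - + i - 1ℤ ≡ n ⊖ suc i
  n-i-1≡ = trans (solve 2 (λ n i → n :- i :- con 1ℤ := n :- (con 1ℤ :+ i)) refl (+ n) (+ i))
                 (ℤP.m-n≡m⊖n n (suc i))

0<shiftedBinom : ∀ {n r i} → i ≤ r → r < n → 0 < shiftedBinom n r i
0<shiftedBinom {suc n} {r} {zero} _ (s≤s r≤n) = k≤n⇒0<nCk r≤n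
0<shiftedBinom {suc n} {suc r} {suc i} (s≤s i≤r) (s≤s r<n) = 0<shiftedBinom i≤r r<n

shiftedBinom-indep : ∀ n m {r i} → r ≤ i → shiftedBinom n r i ≡ shiftedBinom m r i
shiftedBinom-indep n m {zero} {zero} _ = refl
shiftedBinom-indep n m {zero} {suc i} _ = refl
shiftedBinom-indep n m {suc r} {suc i} (s≤s r≤i) = shiftedBinom-indep (pred n) (pred m) r≤i

shiftedBinom-pascal : ∀ {n r} i → 1 ≤ r → r ≤ n →
  shiftedBinom (suc n) r i ≡ shiftedBinom n r i ℕ.+ shiftedBinom n (pred r) i
shiftedBinom-pascal {suc n} {suc r} zero _ _ =
  trans (sym (nCk+nC[k+1]≡[n+1]C[k+1] n r)) (ℕP.+-comm (n C r) _)
shiftedBinom-pascal {suc n} {suc zero} (suc zero) _ _ = refl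
shiftedBinom-pascal {suc n} {suc zero} (suc (suc i)) _ _ = refl
shiftedBinom-pascal {suc n} {suc (suc r)} (suc i) _ (s≤s r<n) = shiftedBinom-pascal i (s≤s z≤n) r<n

shiftedBinom-<-suc : ∀ {n r i} → i < r → r ≤ n → shiftedBinom n r i < shiftedBinom (suc n) r i
shiftedBinom-<-suc {n} {suc r} {i} (s≤s i≤r) r<n = begin-strict
    shiftedBinom n (suc r) i                             <⟨ ℕP.m<m+n _ (0<shiftedBinom i≤r r<n) ⟩
    shiftedBinom n (suc r) i ℕ.+ shiftedBinom n r i      ≡⟨ shiftedBinom-pascal i (s≤s z≤n) r<n ⟨
    shiftedBinom (suc n) (suc r) i                       ∎
  where open ℕP.≤-Reasoning

record SharpBound (x : ℤ) (b : ℕ) (P : Set) : Set where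
  field
    bounded  : x ℤ.≤ + b
    attained : x ≡ + b ⇔ P

open SharpBound

sharp-exact : ∀ {x b P} → x ≡ + b → P → SharpBound x b P
sharp-exact x≡b p = record { bounded = ℤP.≤-reflexive x≡b ; attained = mk⇔ (const p) (const x≡b) }

sharp-strict : ∀ {x b′ b P} → x ℤ.≤ + b′ → b′ < b → ¬ P → SharpBound x b P
sharp-strict {x} {b′} x≤b′ b′<b ¬p = record
  { bounded  = ℤP.≤-trans x≤b′ (ℤ.+≤+ (ℕP.<⇒≤ b′<b))
  ; attained = mk⇔ (λ x≡b → contradiction (ℤP.drop‿+≤+ (subst (ℤ._≤ + b′) x≡b x≤b′)) (ℕP.<⇒≱ b′<b))
                   (λ p → contradiction p ¬p)
  }

+-tightˡ : ∀ {x y b c} → x ℤ.≤ b → y ℤ.≤ c → x + y ≡ b + c → x ≡ b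
+-tightˡ {x} {y} {b} x≤b y≤c x+y≡b+c with x ℤ.≟ b
... | yes x≡b = x≡b
... | no x≢b = contradiction x+y≡b+c (ℤP.<⇒≢ (ℤP.+-mono-<-≤ (ℤP.≤∧≢⇒< x≤b x≢b) y≤c))

sharp-+ : ∀ {x y b c P Q} → SharpBound x b P → SharpBound y c Q → SharpBound (x + y) (b ℕ.+ c) (P × Q)
sharp-+ {x} {y} {b} {c} sx sy = record
  { bounded  = ℤP.+-mono-≤ (bounded sx) (bounded sy)
  ; attained = mk⇔ (λ eq → to (attained sx) (+-tightˡ (bounded sx) (bounded sy) eq)
                         , to (attained sy) (+-tightˡ (bounded sy) (bounded sx) (swap eq)))
                   (λ (p , q) → cong₂ _+_ (from (attained sx) p) (from (attained sy) q))
  }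
  where
  swap : x + y ≡ + b + + c → y + x ≡ + c + + b
  swap eq = trans (ℤP.+-comm y x) (trans eq (ℤP.+-comm (+ b) (+ c)))

SharpBound-resp : ∀ {x x′ b b′ P Q} → x ≡ x′ → b ≡ b′ → P ⇔ Q → SharpBound x b P → SharpBound x′ b′ Q
SharpBound-resp refl refl P⇔Q s = record { bounded = bounded s ; attained = ⇔-trans (attained s) P⇔Q }

Independent : ∀ {n} → Matroid n → Subset n → Set
Independent M A = rk M A ≡ ∣ A ∣

SmallSetsIndependent : ∀ {n} → Matroid n → ℕ → Set
SmallSetsIndependent M i = ∀ A → ∣ A ∣ ℕ.+ i ≤ rank M → Independent M A

module _ {n} (M : Matroid n) where

  rank≤n : rank M ≤ n
  rank≤n = subst (rank M ≤_) (∣⊤∣≡n n) (rk-bounded M ⊤)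

  rk-⊥ : rk M ⊥ ≡ 0
  rk-⊥ = ℕP.n≤0⇒n≡0 (subst (rk M ⊥ ≤_) (∣⊥∣≡0 n) (rk-bounded M ⊥))

  empty-independent : ∀ {A} → ∣ A ∣ ≡ 0 → Independent M A
  empty-independent {A} ∣A∣≡0 =
    trans (ℕP.n≤0⇒n≡0 (subst (rk M A ≤_) ∣A∣≡0 (rk-bounded M A))) (sym ∣A∣≡0)

  smallSetsIndependent-trivial : ∀ {i} → rank M ≤ i → SmallSetsIndependent M i
  smallSetsIndependent-trivial {i} r≤i A ∣A∣+i≤r =
    empty-independent (ℕP.n≤0⇒n≡0 (ℕP.+-cancelʳ-≤ i ∣ A ∣ 0 (ℕP.≤-trans ∣A∣+i≤r r≤i)))

  -- Submodularity applied to A and its complement.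
  rank≡n⇒independent : rank M ≡ n → ∀ A → Independent M A
  rank≡n⇒independent r≡n A = ℕP.≤-antisym (rk-bounded M A) (ℕP.+-cancelʳ-≤ k ∣ A ∣ (rk M A) ∣A∣+k≤rkA+k)
    where
    open ℕP.≤-Reasoning
    k = n ∸ ∣ A ∣
    ∣A∣+k≤rkA+k : ∣ A ∣ ℕ.+ k ≤ rk M A ℕ.+ k
    ∣A∣+k≤rkA+k = begin
      ∣ A ∣ ℕ.+ k                     ≡⟨ ℕP.m+[n∸m]≡n (∣p∣≤n A) ⟩
      n                               ≡⟨ r≡n ⟨
      rk M ⊤                          ≡⟨ cong (rk M) (∪-inverseʳ A) ⟨
      rk M (A ∪ ∁ A)                  ≡⟨ ℕP.+-identityʳ _ ⟨
      rk M (A ∪ ∁ A) ℕ.+ 0            ≡⟨ cong (rk M (A ∪ ∁ A) ℕ.+_) (trans (cong (rk M) (∩-inverseʳ A)) rk-⊥) ⟨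
      rk M (A ∪ ∁ A) ℕ.+ rk M (A ∩ ∁ A)  ≤⟨ rk-submod M A (∁ A) ⟩
      rk M A ℕ.+ rk M (∁ A)           ≤⟨ ℕP.+-monoʳ-≤ (rk M A) (rk-bounded M (∁ A)) ⟩
      rk M A ℕ.+ ∣ ∁ A ∣              ≡⟨ cong (rk M A ℕ.+_) (∣∁p∣≡n∸∣p∣ A) ⟩
      rk M A ℕ.+ k                    ∎

subsetOfSize : ∀ {k n} → k ≤ n → Σ[ S ∈ Subset n ] ∣ S ∣ ≡ k
subsetOfSize {zero} {n} _ = ⊥ , ∣⊥∣≡0 n
subsetOfSize {suc k} {suc n} (s≤s k≤n) with subsetOfSize k≤n
... | S , ∣S∣≡k = true ∷ S , cong suc ∣S∣≡k

TutteBound : ∀ {n} → Matroid n → ℕ → Set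
TutteBound {n} M i =
  SharpBound (tutteCoeff M i) (shiftedBinom n (rank M) i) (SmallSetsIndependent M i)

tutteBound-empty : (M : Matroid 0) → ∀ i → TutteBound M i
tutteBound-empty M i = sharp-exact (tutteCoeff≡ i) λ { [] _ → empty-independent M refl }
  where
  tutteCoeff≡ : ∀ i → tutteCoeff M i ≡ + shiftedBinom 0 (rank M) i
  tutteCoeff≡ i with rk M [] | rk-⊥ M
  tutteCoeff≡ zero | .0 | refl = refl
  tutteCoeff≡ (suc i) | .0 | refl = refl

module FirstElement {n} (M : Matroid (suc n)) where

  rk⁻ rk⁺ : Subset n → ℕ
  rk⁻ A = rk M (false ∷ A)
  rk⁺ A = rk M (true ∷ A)

  rk₀ : ℕ
  rk₀ = rk⁺ ⊥

  rk₀≤1 : rk₀ ≤ 1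
  rk₀≤1 = subst (λ k → rk₀ ≤ suc k) (∣⊥∣≡0 n) (rk-bounded M (true ∷ ⊥))

  rk⁻≤rk⁺ : ∀ A → rk⁻ A ≤ rk⁺ A
  rk⁻≤rk⁺ A = rk-mono M (out⊆ ⊆-refl)

  rk₀≤rk⁺ : ∀ A → rk₀ ≤ rk⁺ A
  rk₀≤rk⁺ A = rk-mono M (s⊆s (⊆-min A))

  rk⁻≤rk⁻⊤ : ∀ A → rk⁻ A ≤ rk⁻ ⊤
  rk⁻≤rk⁻⊤ A = rk-mono M (s⊆s (⊆-max A))

  rk⁺≤rk₀+rk⁻ : ∀ A → rk⁺ A ≤ rk₀ ℕ.+ rk⁻ A
  rk⁺≤rk₀+rk⁻ A = begin
    rk⁺ A                            ≡⟨ cong rk⁺ (∪-identityˡ A) ⟨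
    rk⁺ (⊥ ∪ A)                      ≡⟨ ℕP.+-identityʳ _ ⟨
    rk⁺ (⊥ ∪ A) ℕ.+ 0                ≡⟨ cong (rk⁺ (⊥ ∪ A) ℕ.+_) (trans (cong rk⁻ (∩-zeroˡ A)) (rk-⊥ M)) ⟨
    rk⁺ (⊥ ∪ A) ℕ.+ rk⁻ (⊥ ∩ A)      ≤⟨ rk-submod M (true ∷ ⊥) (false ∷ A) ⟩
    rk₀ ℕ.+ rk⁻ A                    ∎
    where open ℕP.≤-Reasoning

  loop⇒rk⁺≡rk⁻ : rk₀ ≡ 0 → ∀ A → rk⁺ A ≡ rk⁻ A
  loop⇒rk⁺≡rk⁻ rk₀≡0 A =
    ℕP.≤-antisym (subst (λ k → rk⁺ A ≤ k ℕ.+ rk⁻ A) rk₀≡0 (rk⁺≤rk₀+rk⁻ A)) (rk⁻≤rk⁺ A)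

  coloop⇒rk⁺≡1+rk⁻ : suc (rk⁻ ⊤) ≡ rk⁺ ⊤ → ∀ A → rk⁺ A ≡ suc (rk⁻ A)
  coloop⇒rk⁺≡1+rk⁻ 1+rk⁻⊤≡rk⁺⊤ A =
    ℕP.≤-antisym (ℕP.≤-trans (rk⁺≤rk₀+rk⁻ A) (ℕP.+-monoˡ-≤ (rk⁻ A) rk₀≤1))
                 (ℕP.+-cancelʳ-≤ (rk⁻ ⊤) (suc (rk⁻ A)) (rk⁺ A) submod)
    where
    open ℕP.≤-Reasoning
    submod : suc (rk⁻ A) ℕ.+ rk⁻ ⊤ ≤ rk⁺ A ℕ.+ rk⁻ ⊤
    submod = begin
      suc (rk⁻ A) ℕ.+ rk⁻ ⊤            ≡⟨ cong suc (ℕP.+-comm (rk⁻ A) (rk⁻ ⊤)) ⟩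
      suc (rk⁻ ⊤) ℕ.+ rk⁻ A            ≡⟨ cong (ℕ._+ rk⁻ A) 1+rk⁻⊤≡rk⁺⊤ ⟩
      rk⁺ ⊤ ℕ.+ rk⁻ A                  ≡⟨ cong₂ (λ X Y → rk⁺ X ℕ.+ rk⁻ Y) (∪-zeroʳ A) (∩-identityʳ A) ⟨
      rk⁺ (A ∪ ⊤) ℕ.+ rk⁻ (A ∩ ⊤)      ≤⟨ rk-submod M (true ∷ A) (false ∷ ⊤) ⟩
      rk⁺ A ℕ.+ rk⁻ ⊤                  ∎

  1≤rk⁺ : rk₀ ≡ 1 → ∀ A → 1 ≤ rk⁺ A
  1≤rk⁺ rk₀≡1 A = subst (_≤ rk⁺ A) rk₀≡1 (rk₀≤rk⁺ A)

  deletion : Matroid n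
  deletion = record
    { rk         = rk⁻
    ; rk-bounded = λ A → rk-bounded M (false ∷ A)
    ; rk-mono    = λ A⊆B → rk-mono M (s⊆s A⊆B)
    ; rk-submod  = λ A B → rk-submod M (false ∷ A) (false ∷ B)
    }

  contraction : rk₀ ≡ 1 → Matroid n
  contraction rk₀≡1 = record
    { rk         = λ A → pred (rk⁺ A)
    ; rk-bounded = λ A → ℕP.pred-mono-≤ (ℕP.≤-trans (rk⁺≤rk₀+rk⁻ A)
                     (subst (λ k → k ℕ.+ rk⁻ A ≤ suc ∣ A ∣) (sym rk₀≡1) (s≤s (rk-bounded M (false ∷ A)))))
    ; rk-mono    = λ A⊆B → ℕP.pred-mono-≤ (rk-mono M (s⊆s A⊆B))
    ; rk-submod  = λ A B → pred-+-mono-≤ (1≤rk⁺ rk₀≡1 (A ∪ B)) (1≤rk⁺ rk₀≡1 (A ∩ B))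
                     (1≤rk⁺ rk₀≡1 A) (1≤rk⁺ rk₀≡1 B) (rk-submod M (true ∷ A) (true ∷ B))
    }

  data Kind : Set where
    loop     : rk₀ ≡ 0 → Kind
    coloop   : suc (rk⁻ ⊤) ≡ rk⁺ ⊤ → Kind
    ordinary : rk₀ ≡ 1 → rk⁻ ⊤ ≡ rk⁺ ⊤ → Kind

  kind : Kind
  kind with ℕP.m≤n⇒m<n∨m≡n rk₀≤1
  ... | inj₁ rk₀<1 = loop (ℕP.n<1⇒n≡0 rk₀<1)
  ... | inj₂ rk₀≡1 with ℕP.m≤n⇒m<n∨m≡n (rk⁻≤rk⁺ ⊤)
  ...   | inj₂ rk⁻⊤≡rk⁺⊤ = ordinary rk₀≡1 rk⁻⊤≡rk⁺⊤
  ...   | inj₁ rk⁻⊤<rk⁺⊤ = coloop (ℕP.≤-antisym rk⁻⊤<rk⁺⊤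
           (subst (λ k → rk⁺ ⊤ ≤ k ℕ.+ rk⁻ ⊤) rk₀≡1 (rk⁺≤rk₀+rk⁻ ⊤)))

  tutteCoeff-split : ∀ i → tutteCoeff M i
    ≡ sumOver (allSubsets n) (λ A → tutteTerm M i (false ∷ A) + tutteTerm M i (true ∷ A))
  tutteCoeff-split i = sumOver-allSubsets-suc n (tutteTerm M i)

  tutteTerm-loop : rk₀ ≡ 0 → ∀ i A →
    tutteTerm M i (false ∷ A) + tutteTerm M i (true ∷ A) ≡ tutteTerm deletion i A
  tutteTerm-loop rk₀≡0 i A = begin
      tutteTerm M i (false ∷ A) + tutteTerm M i (true ∷ A)
    ≡⟨ cong₂ (λ r t → coeffPow (r ∸ rk⁻ A) i * powAt1 (∣ A ∣ ∸ rk⁻ A) + t)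
             (loop⇒rk⁺≡rk⁻ rk₀≡0 ⊤) (trans (cong (c *_) dependent) (ℤP.*-zeroʳ c)) ⟩
      tutteTerm deletion i A + 0ℤ
    ≡⟨ ℤP.+-identityʳ _ ⟩
      tutteTerm deletion i A
    ∎
    where
    open ≡-Reasoning
    c = coeffPow (rk⁺ ⊤ ∸ rk⁺ A) i
    dependent : powAt1 (suc ∣ A ∣ ∸ rk⁺ A) ≡ 0ℤ
    dependent = powAt1-suc-∸ ∣ A ∣ (subst (_≤ ∣ A ∣) (sym (loop⇒rk⁺≡rk⁻ rk₀≡0 A)) (rk-bounded M (false ∷ A)))

  tutteTerm-ordinary : (rk₀≡1 : rk₀ ≡ 1) → rk⁻ ⊤ ≡ rk⁺ ⊤ → ∀ i A →
    tutteTerm M i (false ∷ A) + tutteTerm M i (true ∷ A)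
      ≡ tutteTerm deletion i A + tutteTerm (contraction rk₀≡1) i A
  tutteTerm-ordinary rk₀≡1 rk⁻⊤≡rk⁺⊤ i A = cong₂ _+_
    (cong (λ r → coeffPow (r ∸ rk⁻ A) i * powAt1 (∣ A ∣ ∸ rk⁻ A)) (sym rk⁻⊤≡rk⁺⊤))
    (cong₂ (λ m b → coeffPow m i * powAt1 b)
      (sym (pred-∸-pred (1≤rk⁺ rk₀≡1 ⊤) (1≤rk⁺ rk₀≡1 A))) (sym (∸-pred ∣ A ∣ (1≤rk⁺ rk₀≡1 A))))

  tutteTerm-coloop : suc (rk⁻ ⊤) ≡ rk⁺ ⊤ → ∀ i A →
    tutteTerm M i (false ∷ A) + tutteTerm M i (true ∷ A)
      ≡ (coeffPow (suc (rk⁻ ⊤ ∸ rk⁻ A)) i + coeffPow (rk⁻ ⊤ ∸ rk⁻ A) i) * powAt1 (∣ A ∣ ∸ rk⁻ A)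
  tutteTerm-coloop 1+rk⁻⊤≡rk⁺⊤ i A = begin
      tutteTerm M i (false ∷ A) + tutteTerm M i (true ∷ A)
    ≡⟨ cong₂ (λ m r → coeffPow m i * z + coeffPow (rk⁺ ⊤ ∸ r) i * powAt1 (suc ∣ A ∣ ∸ r))
             rk⁺⊤∸rk⁻A (coloop⇒rk⁺≡1+rk⁻ 1+rk⁻⊤≡rk⁺⊤ A) ⟩
      coeffPow (suc m) i * z + coeffPow (rk⁺ ⊤ ∸ suc (rk⁻ A)) i * z
    ≡⟨ cong (λ r → coeffPow (suc m) i * z + coeffPow (r ∸ suc (rk⁻ A)) i * z) 1+rk⁻⊤≡rk⁺⊤ ⟨
      coeffPow (suc m) i * z + coeffPow m i * z
    ≡⟨ ℤP.*-distribʳ-+ z (coeffPow (suc m) i) (coeffPow m i) ⟨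
      (coeffPow (suc m) i + coeffPow m i) * z
    ∎
    where
    open ≡-Reasoning
    m = rk⁻ ⊤ ∸ rk⁻ A
    z = powAt1 (∣ A ∣ ∸ rk⁻ A)
    rk⁺⊤∸rk⁻A : rk⁺ ⊤ ∸ rk⁻ A ≡ suc m
    rk⁺⊤∸rk⁻A = trans (cong (_∸ rk⁻ A) (sym 1+rk⁻⊤≡rk⁺⊤)) (ℕP.+-∸-assoc 1 (rk⁻≤rk⁻⊤ A))

  tutteCoeff-loop : rk₀ ≡ 0 → ∀ i → tutteCoeff M i ≡ tutteCoeff deletion i
  tutteCoeff-loop rk₀≡0 i =
    trans (tutteCoeff-split i) (sumOver-cong (allSubsets n) (tutteTerm-loop rk₀≡0 i))

  tutteCoeff-ordinary : (rk₀≡1 : rk₀ ≡ 1) → rk⁻ ⊤ ≡ rk⁺ ⊤ → ∀ i →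
    tutteCoeff M i ≡ tutteCoeff deletion i + tutteCoeff (contraction rk₀≡1) i
  tutteCoeff-ordinary rk₀≡1 rk⁻⊤≡rk⁺⊤ i =
    trans (tutteCoeff-split i) (trans (sumOver-cong (allSubsets n) (tutteTerm-ordinary rk₀≡1 rk⁻⊤≡rk⁺⊤ i))
                                      (sumOver-+ (allSubsets n) (tutteTerm deletion i) (tutteTerm (contraction rk₀≡1) i)))

  tutteCoeff-coloop-zero : suc (rk⁻ ⊤) ≡ rk⁺ ⊤ → tutteCoeff M 0 ≡ 0ℤ
  tutteCoeff-coloop-zero 1+rk⁻⊤≡rk⁺⊤ = trans (tutteCoeff-split 0) (sumOver-zero (allSubsets n) λ A →
    trans (tutteTerm-coloop 1+rk⁻⊤≡rk⁺⊤ 0 A) (cong (_* powAt1 (∣ A ∣ ∸ rk⁻ A)) (coeffPow-suc-+-zero (rk⁻ ⊤ ∸ rk⁻ A))))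

  tutteCoeff-coloop-suc : suc (rk⁻ ⊤) ≡ rk⁺ ⊤ → ∀ i → tutteCoeff M (suc i) ≡ tutteCoeff deletion i
  tutteCoeff-coloop-suc 1+rk⁻⊤≡rk⁺⊤ i = trans (tutteCoeff-split (suc i)) (sumOver-cong (allSubsets n) λ A →
    trans (tutteTerm-coloop 1+rk⁻⊤≡rk⁺⊤ (suc i) A) (cong (_* powAt1 (∣ A ∣ ∸ rk⁻ A)) (coeffPow-suc-+-suc (rk⁻ ⊤ ∸ rk⁻ A) i)))

  smallSetsIndependent-ordinary : (rk₀≡1 : rk₀ ≡ 1) → rk⁻ ⊤ ≡ rk⁺ ⊤ → ∀ i →
    SmallSetsIndependent M i
      ⇔ (SmallSetsIndependent deletion i × SmallSetsIndependent (contraction rk₀≡1) i)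
  smallSetsIndependent-ordinary rk₀≡1 rk⁻⊤≡rk⁺⊤ i = mk⇔ split join
    where
    split : SmallSetsIndependent M i →
            SmallSetsIndependent deletion i × SmallSetsIndependent (contraction rk₀≡1) i
    split indep = (λ A small → indep (false ∷ A) (subst (∣ A ∣ ℕ.+ i ≤_) rk⁻⊤≡rk⁺⊤ small))
                , (λ A small → cong pred (indep (true ∷ A)
                     (ℕP.m≤pred[n]⇒suc[m]≤n {{ℕ.>-nonZero (1≤rk⁺ rk₀≡1 ⊤)}} small)))
    join : SmallSetsIndependent deletion i × SmallSetsIndependent (contraction rk₀≡1) i →
           SmallSetsIndependent M i
    join (indep⁻ , _) (false ∷ A) small = indep⁻ A (subst (∣ A ∣ ℕ.+ i ≤_) (sym rk⁻⊤≡rk⁺⊤) small)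
    join (_ , indep⁺) (true ∷ A) small =
      pred≡⇒≡suc (1≤rk⁺ rk₀≡1 A) (indep⁺ A (ℕP.suc[m]≤n⇒m≤pred[n] small))

  smallSetsIndependent-coloop : suc (rk⁻ ⊤) ≡ rk⁺ ⊤ → ∀ i →
    SmallSetsIndependent M (suc i) ⇔ SmallSetsIndependent deletion i
  smallSetsIndependent-coloop 1+rk⁻⊤≡rk⁺⊤ i = mk⇔ restrict extend
    where
    unshift : ∀ k → k ℕ.+ suc i ≤ rk⁺ ⊤ → k ℕ.+ i ≤ rk⁻ ⊤
    unshift k small = ℕP.≤-pred (subst₂ _≤_ (ℕP.+-suc k i) (sym 1+rk⁻⊤≡rk⁺⊤) small)
    restrict : SmallSetsIndependent M (suc i) → SmallSetsIndependent deletion i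
    restrict indep A small =
      indep (false ∷ A) (subst₂ _≤_ (sym (ℕP.+-suc ∣ A ∣ i)) 1+rk⁻⊤≡rk⁺⊤ (s≤s small))
    extend : SmallSetsIndependent deletion i → SmallSetsIndependent M (suc i)
    extend indep (false ∷ A) small = indep A (unshift ∣ A ∣ small)
    extend indep (true ∷ A) small = trans (coloop⇒rk⁺≡1+rk⁻ 1+rk⁻⊤≡rk⁺⊤ A)
      (cong suc (indep A (ℕP.≤-trans (ℕP.n≤1+n _) (unshift (suc ∣ A ∣) small))))

  ¬smallSetsIndependent-loop : rk₀ ≡ 0 → ∀ {i} → i < rk⁺ ⊤ → ¬ SmallSetsIndependent M i
  ¬smallSetsIndependent-loop rk₀≡0 {i} i<r indep =
    ℕP.0≢1+n (trans (sym rk₀≡0) (indep (true ∷ ⊥) (subst (λ k → suc (k ℕ.+ i) ≤ rk⁺ ⊤) (sym (∣⊥∣≡0 n)) i<r)))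

  ¬smallSetsIndependent-coloop : suc (rk⁻ ⊤) ≡ rk⁺ ⊤ → rk⁻ ⊤ < n → ¬ SmallSetsIndependent M 0
  ¬smallSetsIndependent-coloop 1+rk⁻⊤≡rk⁺⊤ rk⁻⊤<n indep with subsetOfSize rk⁻⊤<n
  ... | S , ∣S∣≡1+rk⁻⊤ =
    ℕP.1+n≰n (subst (_≤ rk⁻ ⊤) (trans (indep (false ∷ S) small) ∣S∣≡1+rk⁻⊤) (rk⁻≤rk⁻⊤ S))
    where
    small : ∣ S ∣ ℕ.+ 0 ≤ rk⁺ ⊤
    small = ℕP.≤-reflexive (trans (ℕP.+-identityʳ _) (trans ∣S∣≡1+rk⁻⊤ 1+rk⁻⊤≡rk⁺⊤))

  tutteBound-loop : rk₀ ≡ 0 → (∀ i → TutteBound deletion i) → ∀ i → TutteBound M i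
  tutteBound-loop rk₀≡0 ih i = SharpBound-resp (sym (tutteCoeff-loop rk₀≡0 i))
    (cong (λ r → shiftedBinom (suc n) r i) (sym rk⁺⊤≡rk⁻⊤)) (⇔-id _) bound
    where
    rk⁺⊤≡rk⁻⊤ = loop⇒rk⁺≡rk⁻ rk₀≡0 ⊤
    bound : SharpBound (tutteCoeff deletion i) (shiftedBinom (suc n) (rk⁻ ⊤) i) (SmallSetsIndependent M i)
    bound with rk⁻ ⊤ ℕP.≤? i
    ... | yes r≤i = sharp-exact
      (trans (from (attained (ih i)) (smallSetsIndependent-trivial deletion r≤i))
             (cong +_ (shiftedBinom-indep n (suc n) r≤i)))
      (smallSetsIndependent-trivial M (subst (_≤ i) (sym rk⁺⊤≡rk⁻⊤) r≤i))
    ... | no r≰i = sharp-strict (bounded (ih i)) (shiftedBinom-<-suc i<r (rank≤n deletion))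
      (¬smallSetsIndependent-loop rk₀≡0 (subst (i <_) (sym rk⁺⊤≡rk⁻⊤) i<r))
      where i<r = ℕP.≰⇒> r≰i

  tutteBound-ordinary : (rk₀≡1 : rk₀ ≡ 1) → rk⁻ ⊤ ≡ rk⁺ ⊤ →
    (∀ (N : Matroid n) i → TutteBound N i) → ∀ i → TutteBound M i
  tutteBound-ordinary rk₀≡1 rk⁻⊤≡rk⁺⊤ ih i =
    SharpBound-resp (sym (tutteCoeff-ordinary rk₀≡1 rk⁻⊤≡rk⁺⊤ i)) (sym pascal)
      (⇔-sym (smallSetsIndependent-ordinary rk₀≡1 rk⁻⊤≡rk⁺⊤ i))
      (sharp-+ (ih deletion i) (ih (contraction rk₀≡1) i))
    where
    pascal : shiftedBinom (suc n) (rk⁺ ⊤) i ≡ shiftedBinom n (rk⁻ ⊤) i ℕ.+ shiftedBinom n (pred (rk⁺ ⊤)) i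
    pascal = trans (shiftedBinom-pascal i (1≤rk⁺ rk₀≡1 ⊤) (subst (_≤ n) rk⁻⊤≡rk⁺⊤ (rank≤n deletion)))
                   (cong (λ r → shiftedBinom n r i ℕ.+ shiftedBinom n (pred (rk⁺ ⊤)) i) (sym rk⁻⊤≡rk⁺⊤))

  tutteBound-coloop : suc (rk⁻ ⊤) ≡ rk⁺ ⊤ → (∀ i → TutteBound deletion i) → ∀ i → TutteBound M i
  tutteBound-coloop 1+rk⁻⊤≡rk⁺⊤ ih (suc i) =
    SharpBound-resp (sym (tutteCoeff-coloop-suc 1+rk⁻⊤≡rk⁺⊤ i))
      (cong (λ r → shiftedBinom (suc n) r (suc i)) 1+rk⁻⊤≡rk⁺⊤)
      (⇔-sym (smallSetsIndependent-coloop 1+rk⁻⊤≡rk⁺⊤ i)) (ih i)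
  tutteBound-coloop 1+rk⁻⊤≡rk⁺⊤ ih zero with ℕP.m≤n⇒m<n∨m≡n (rank≤n deletion)
  ... | inj₁ rk⁻⊤<n = sharp-strict {b′ = 0} (ℤP.≤-reflexive (tutteCoeff-coloop-zero 1+rk⁻⊤≡rk⁺⊤))
    (k≤n⇒0<nCk (subst (_≤ n) 1+rk⁻⊤≡rk⁺⊤ rk⁻⊤<n)) (¬smallSetsIndependent-coloop 1+rk⁻⊤≡rk⁺⊤ rk⁻⊤<n)
  ... | inj₂ rk⁻⊤≡n = sharp-exact
    (trans (tutteCoeff-coloop-zero 1+rk⁻⊤≡rk⁺⊤)
           (cong +_ (sym (k>n⇒nCk≡0 (ℕP.≤-reflexive (trans (cong suc (sym rk⁻⊤≡n)) 1+rk⁻⊤≡rk⁺⊤))))))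
    (λ A _ → rank≡n⇒independent M (trans (sym 1+rk⁻⊤≡rk⁺⊤) (cong suc rk⁻⊤≡n)) A)

  tutteBound-step : (∀ (N : Matroid n) i → TutteBound N i) → ∀ i → TutteBound M i
  tutteBound-step ih with kind
  ... | loop rk₀≡0 = tutteBound-loop rk₀≡0 (ih deletion)
  ... | coloop 1+rk⁻⊤≡rk⁺⊤ = tutteBound-coloop 1+rk⁻⊤≡rk⁺⊤ (ih deletion)
  ... | ordinary rk₀≡1 rk⁻⊤≡rk⁺⊤ = tutteBound-ordinary rk₀≡1 rk⁻⊤≡rk⁺⊤ ih

tutteBound : ∀ {n} (M : Matroid n) i → TutteBound M i
tutteBound {zero} M = tutteBound-empty M
tutteBound {suc n} M = FirstElement.tutteBound-step M (tutteBound {n})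

suc∣p─⁅x⁆∣≡∣p∣ : ∀ {n} {p : Subset n} {x} → x ∈ p → suc ∣ p ─ ⁅ x ⁆ ∣ ≡ ∣ p ∣
suc∣p─⁅x⁆∣≡∣p∣ {p = true ∷ p} here = cong (λ q → suc ∣ q ∣) (p─⊥≡p p)
suc∣p─⁅x⁆∣≡∣p∣ {p = true ∷ p} (there x∈p) = cong suc (suc∣p─⁅x⁆∣≡∣p∣ x∈p)
suc∣p─⁅x⁆∣≡∣p∣ {p = false ∷ p} (there x∈p) = suc∣p─⁅x⁆∣≡∣p∣ x∈p

module _ {n} (M : Matroid n) where

  minimallyDependent⇒circuit : ∀ {A} → ¬ Independent M A →
    (∀ e → e ∈ A → Independent M (A ─ ⁅ e ⁆)) → IsCircuit M A
  minimallyDependent⇒circuit {A} dependent indep =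
    rk+1≡∣A∣ , λ e e∈A → trans (ℕP.+-comm _ 1) (trans (cong suc (indep e e∈A)) (suc∣p─⁅x⁆∣≡∣p∣ e∈A))
    where
    rk+1≡∣A∣ : rk M A ℕ.+ 1 ≡ ∣ A ∣
    rk+1≡∣A∣ with nonempty? A
    ... | no empty = contradiction (empty-independent M (trans (cong ∣_∣ (Empty-unique empty)) (∣⊥∣≡0 n))) dependent
    ... | yes (e , e∈A) = trans (ℕP.+-comm _ 1) (ℕP.≤-antisym (ℕP.≤∧≢⇒< (rk-bounded M A) dependent) (begin
        ∣ A ∣                      ≡⟨ suc∣p─⁅x⁆∣≡∣p∣ e∈A ⟨
        suc ∣ A ─ ⁅ e ⁆ ∣          ≡⟨ cong suc (indep e e∈A) ⟨
        suc (rk M (A ─ ⁅ e ⁆))     ≤⟨ s≤s (rk-mono M (p─q⊆p A ⁅ e ⁆)) ⟩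
        suc (rk M A)               ∎))
      where open ℕP.≤-Reasoning

  dependent⇒circuit : ∀ {A} → ¬ Independent M A → ∃[ C′ ] IsCircuit M C′ × ∣ C′ ∣ ≤ ∣ A ∣
  dependent⇒circuit {A} = search A (⊂-wellFounded A)
    where
    search : ∀ A → Acc _⊂_ A → ¬ Independent M A → ∃[ C′ ] IsCircuit M C′ × ∣ C′ ∣ ≤ ∣ A ∣
    search A (acc smaller) dependent
      with any? (λ e → (e ∈? A) ×-dec ¬? (rk M (A ─ ⁅ e ⁆) ℕP.≟ ∣ A ─ ⁅ e ⁆ ∣))
    ... | yes (e , e∈A , dependent′) with search (A ─ ⁅ e ⁆) (smaller (x∈p⇒p-x⊂p e∈A)) dependent′
    ...   | C′ , circuit , ∣C′∣≤ = C′ , circuit , ℕP.≤-trans ∣C′∣≤ (∣p─q∣≤∣p∣ A ⁅ e ⁆)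
    search A _ dependent | no ¬∃ = A , minimallyDependent⇒circuit dependent indep , ℕP.≤-refl
      where
      indep : ∀ e → e ∈ A → Independent M (A ─ ⁅ e ⁆)
      indep e e∈A = decidable-stable (rk M (A ─ ⁅ e ⁆) ℕP.≟ ∣ A ─ ⁅ e ⁆ ∣) λ dep → ¬∃ (e , e∈A , dep)

m-n<o⇔m<o+n : ∀ m n o → + m - + n ℤ.< + o ⇔ m < o ℕ.+ n
m-n<o⇔m<o+n m n o = mk⇔
  (λ lt → ℤP.drop‿+<+ (subst (ℤ._< + o + + n) (solve 2 (λ m n → m :- n :+ n := m) refl (+ m) (+ n))
                                          (ℤP.+-monoˡ-< (+ n) lt)))
  (λ lt → subst (+ m - + n ℤ.<_) (solve 2 (λ o n → o :+ n :- n := o) refl (+ o) (+ n))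
                                  (ℤP.+-monoˡ-< (- + n) (ℤ.+<+ lt)))

d₁>⇔smallSetsIndependent : ∀ {n} (M : Matroid n) i →
  d₁> M (+ rank M - + i) ⇔ SmallSetsIndependent M i
d₁>⇔smallSetsIndependent M i = mk⇔ noSmallCircuit⇒indep indep⇒noSmallCircuit
  where
  noSmallCircuit⇒indep : d₁> M (+ rank M - + i) → SmallSetsIndependent M i
  noSmallCircuit⇒indep d₁>r-i A small = decidable-stable (rk M A ℕP.≟ ∣ A ∣) λ dependent →
    let C′ , circuit , ∣C′∣≤∣A∣ = dependent⇒circuit M dependent
    in ℕP.<⇒≱ (to (m-n<o⇔m<o+n (rank M) i ∣ C′ ∣) (d₁>r-i C′ circuit))
              (ℕP.≤-trans (ℕP.+-monoˡ-≤ i ∣C′∣≤∣A∣) small)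
  indep⇒noSmallCircuit : SmallSetsIndependent M i → d₁> M (+ rank M - + i)
  indep⇒noSmallCircuit indep C′ (rk+1≡∣C′∣ , _) = from (m-n<o⇔m<o+n (rank M) i ∣ C′ ∣) (ℕP.≰⇒> λ small →
    ℕP.1+n≢n (trans (ℕP.+-comm 1 (rk M C′)) (trans rk+1≡∣C′∣ (sym (indep C′ small)))))

≡-resp₂-⇔ : ∀ {A : Set} {x x′ y y′ : A} → x ≡ x′ → y ≡ y′ → (x ≡ y) ⇔ (x′ ≡ y′)
≡-resp₂-⇔ refl refl = mk⇔ id id

theorem3p5 : ∀ {n} (M : Matroid n) (i : ℕ) →
    d₁> M (+ rank M - + i)
      ⇔ (coeff i (evalY (tutte M) 1ℤ)
           ≡ binomℤ (+ n - + i - 1ℤ) (+ rank M - + i))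
theorem3p5 {n} M i =
  ⇔-trans (d₁>⇔smallSetsIndependent M i)
  (⇔-trans (⇔-sym (attained (tutteBound M i)))
           (≡-resp₂-⇔ (sym (coeff-tutte-at-1 M i)) (sym (binomℤ≡shiftedBinom n (rank M) i (rank≤n M)))))
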